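{- For every $n\ge 7$, $\mu(D(C_n))=n$, where $C_n$ is the cycle on $n$ vertices.
   Context: All graphs are finite and simple. The double graph $D(G)$ is obtained from the disjoint union of $G$ and a copy $G'$ with $V(G')=\{u': u\in V(G)\}$ by joining each $u\in V(G)$ to all neighbors of $u'$ in $G'$ and each $u'$ to all neighbors of $u$ in $G$. Given $S\subseteq V(H)$, two vertices $x,y$ are $S$-visible if some shortest $x,y$-path in $H$ has no internal vertex in $S$; $S$ is a mutual-visibility set if every two vertices of $S$ are $S$-visible; $\mu(H)$ is the maximum size of a mutual-visibility set of $H$. -}

module Defs where

open import Data.Nat using (ℕ; zero; suc; _≤_)
open import Data.Fin using (Fin; toℕ)
open import Data.Bool using (Bool)
open import Data.Product using (Σ; _×_; ∃)
open import Data.Sum using (_⊎_)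
open import Data.List using (List; []; _∷_; length)
open import Data.List.Membership.Propositional using (_∈_; _∉_)
open import Data.List.Relation.Unary.All using (All)
open import Data.List.Relation.Unary.Unique.Propositional using (Unique)
open import Relation.Binary.PropositionalEquality using (_≡_)

record Graph : Set₁ where
  field
    V   : Set
    Adj : V → V → Set
open Graph public

CycleStep : (n : ℕ) → Fin n → Fin n → Set
CycleStep n i j = (suc (toℕ i) ≡ toℕ j) ⊎ ((suc (toℕ i) ≡ n) × (toℕ j ≡ 0))

Cycle : ℕ → Graph
Cycle n = record { V = Fin n ; Adj = λ i j → CycleStep n i j ⊎ CycleStep n j i }

-- The double graph D(G): vertices (false , u) = u ∈ G and (true , u) = u' ∈ G'.
-- Edges: u~v, u'~v', u~v', u'~v  exactly when u ~ v in G.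
Double : Graph → Graph
Double G = record { V = Bool × V G ; Adj = λ p q → Adj G (Data.Product.proj₂ p) (Data.Product.proj₂ q) }

data Walk (G : Graph) : V G → V G → Set where
  []  : ∀ {x} → Walk G x x
  _∷_ : ∀ {x y z} → Adj G x y → Walk G y z → Walk G x z

walkLength : ∀ {G x y} → Walk G x y → ℕ
walkLength []      = 0
walkLength (_ ∷ w) = suc (walkLength w)

internals : ∀ {G x y} → Walk G x y → List (V G)
internals []                 = []
internals (_ ∷ [])           = []
internals (_∷_ {y = y} _ w@(_ ∷ _)) = y ∷ internals w

IsShortest : ∀ {G x y} → Walk G x y → Set
IsShortest {G} {x} {y} w = (w' : Walk G x y) → walkLength w ≤ walkLength w'

Visible : (G : Graph) → List (V G) → V G → V G → Set
Visible G S x y = Σ (Walk G x y) λ w → IsShortest w × All (λ v → v ∉ S) (internals w)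

IsMutualVisibility : (G : Graph) → List (V G) → Set
IsMutualVisibility G S = ∀ x y → x ∈ S → y ∈ S → Visible G S x y

MuEquals : Graph → ℕ → Set
MuEquals G k =
  (Σ (List (V G)) λ S → Unique S × IsMutualVisibility G S × length S ≡ k)
  × ((S : List (V G)) → Unique S → IsMutualVisibility G S → length S ≤ k)

module Submission where

-- Lower bound: adjacency in D(G) ignores layers, so a shortest walk between two vertices of G can
-- be rerouted with all its internal vertices in the copy G′; hence V(G) is mutually visible.
-- Upper bound: call column k = {k , k′} full when both vertices lie in S. A walk of length at most
-- d < n/2 from k to k + d on C_n passes every column strictly between, so no full column lies
-- strictly between two occupied columns at distance d ≤ 3 (this is where n ≥ 7 is used). Charge
-- u ∈ S to its column, u′ to its column unless that column is full, and the second vertex of a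
-- full column k to k + 1 if that column is empty and otherwise to k − 1, which is then empty by
-- the case d = 2. The case d = 3 keeps these charges apart, so the charging is injective.

open import Defs
open import Algebra.Properties.CommutativeSemigroup using (x∙yz≈y∙xz)
open import Data.Bool using (Bool; true; false)
import Data.Bool.Properties as Bool
open import Data.Empty using (⊥-elim)
open import Data.Fin using (Fin; toℕ; fromℕ<; zero; suc)
import Data.Fin.Properties as Fin
open import Data.List using (List; []; _∷_; length; map; lookup; allFin)
open import Data.List.Membership.Propositional using (_∈_; _∉_)
open import Data.List.Membership.Propositional.Properties using (∈-lookup; ∈-map⁻)
open import Data.List.Properties using (length-map; length-tabulate)
open import Data.List.Relation.Unary.All as All using (All; []; _∷_)
open import Data.List.Relation.Unary.AllPairs using (_∷_)
open import Data.List.Relation.Unary.Any using (here; there)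
open import Data.List.Relation.Unary.Unique.Propositional using (Unique)
open import Data.List.Relation.Unary.Unique.Propositional.Properties using (map⁺; allFin⁺)
open import Data.Nat using (ℕ; zero; suc; _+_; _∸_; _≤_; _<_; z≤n; s≤s; z<s; NonZero; >-nonZero; >-nonZero⁻¹; _≟_; _<?_)
open import Data.Nat.DivMod using (_%_; m%n<n; m<n⇒m%n≡m; [m+n]%n≡m%n; %-distribˡ-+; m%n%n≡m%n; n%n≡0)
open import Data.Nat.Induction using (<-wellFounded)
open import Data.Nat.Properties
open import Data.Product using (Σ; ∃; _×_; _,_; proj₁; proj₂)
open import Data.Product.Properties using (≡-dec)
open import Data.Sum using (_⊎_; inj₁; inj₂)
open import Induction.WellFounded using (Acc; acc)
open import Relation.Binary.Definitions using (DecidableEquality)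
open import Relation.Binary.PropositionalEquality
open import Relation.Nullary using (¬_; Dec; yes; no)
open import Relation.Nullary.Decidable using (_×-dec_; _⊎-dec_)

internals-∷⁺ : ∀ {G x y z} (e : Adj G x y) (w : Walk G y z) {v} → v ∈ internals w → v ∈ internals (e ∷ w)
internals-∷⁺ e (_ ∷ _) v∈w = there v∈w

module ShortestWalks
  (G : Graph)
  (_≟ᵥ_ : DecidableEquality (V G))
  (adj? : ∀ x y → Dec (Adj G x y))
  (search : ∀ {P : V G → Set} → (∀ v → Dec (P v)) → Dec (∃ P))
  where

  WalkOfLength : ℕ → V G → V G → Set
  WalkOfLength k x y = Σ (Walk G x y) λ w → walkLength w ≡ k

  walkOfLength? : ∀ k x y → Dec (WalkOfLength k x y)
  walkOfLength? zero x y with x ≟ᵥ y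
  ... | yes refl = yes ([] , refl)
  ... | no x≢y = no λ { ([] , _) → x≢y refl ; (_ ∷ _ , ()) }
  walkOfLength? (suc k) x y with search (λ z → adj? x z ×-dec walkOfLength? k z y)
  ... | yes (_ , e , w , refl) = yes (e ∷ w , refl)
  ... | no none = no λ { ([] , ()) ; (e ∷ w , eq) → none (_ , e , w , suc-injective eq) }

  shortest : ∀ {x y} → Walk G x y → Σ (Walk G x y) IsShortest
  shortest w = go w (<-wellFounded (walkLength w))
    where
    go : ∀ {x y} (w : Walk G x y) → Acc _<_ (walkLength w) → Σ (Walk G x y) IsShortest
    go {x} {y} w (acc shorter) with Fin.any? (λ (k : Fin (walkLength w)) → walkOfLength? (toℕ k) x y)
    ... | yes (k , w′ , eq) = go w′ (shorter (subst (_< walkLength w) (sym eq) (Fin.toℕ<n k)))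
    ... | no none = w , λ w′ → ≮⇒≥ λ w′<w → none (fromℕ< w′<w , w′ , sym (Fin.toℕ-fromℕ< w′<w))

module _ {G : Graph} where

  project : ∀ {x y} → Walk (Double G) x y → Walk G (proj₂ x) (proj₂ y)
  project []      = []
  project (e ∷ w) = e ∷ project w

  walkLength-project : ∀ {x y} (w : Walk (Double G) x y) → walkLength (project w) ≡ walkLength w
  walkLength-project []      = refl
  walkLength-project (_ ∷ w) = cong suc (walkLength-project w)

  internals-project : ∀ {x y} (w : Walk (Double G) x y) → internals (project w) ≡ map proj₂ (internals w)
  internals-project []              = refl
  internals-project (_ ∷ [])        = refl
  internals-project (_ ∷ w@(_ ∷ _)) = cong (_ ∷_) (internals-project w)

  raise : ∀ {u v} (b c : Bool) (w : Walk G u v) → 0 < walkLength w → Walk (Double G) (b , u) (c , v)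
  raise b c (e ∷ [])        _ = e ∷ []
  raise b c (e ∷ w@(_ ∷ _)) _ = e ∷ raise true c w z<s

  walkLength-raise : ∀ {u v} b c (w : Walk G u v) (0<w : 0 < walkLength w) → walkLength (raise b c w 0<w) ≡ walkLength w
  walkLength-raise b c (e ∷ [])        _ = refl
  walkLength-raise b c (e ∷ w@(_ ∷ _)) _ = cong suc (walkLength-raise true c w z<s)

  internals-raise : ∀ {u v} b c (w : Walk G u v) (0<w : 0 < walkLength w) →
                    All (λ v → proj₁ v ≡ true) (internals (raise b c w 0<w))
  internals-raise b c (e ∷ [])              _ = []
  internals-raise b c (e ∷ w@(_ ∷ []))      _ = refl ∷ internals-raise true c w z<s
  internals-raise b c (e ∷ w@(_ ∷ _ ∷ _))   _ = refl ∷ internals-raise true c w z<s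

  raise-shortest : ∀ {u v} b c {w : Walk G u v} (0<w : 0 < walkLength w) → IsShortest w → IsShortest (raise b c w 0<w)
  raise-shortest b c {w} 0<w w-shortest w′ = begin
    walkLength (raise b c w 0<w) ≡⟨ walkLength-raise b c w 0<w ⟩
    walkLength w                 ≤⟨ w-shortest (project w′) ⟩
    walkLength (project w′)      ≡⟨ walkLength-project w′ ⟩
    walkLength w′                ∎
    where open ≤-Reasoning

  project-shortest-≤ : ∀ {b c u v} {w : Walk (Double G) (b , u) (c , v)} → IsShortest w →
                       (w′ : Walk G u v) (0<w′ : 0 < walkLength w′) → walkLength (project w) ≤ walkLength w′
  project-shortest-≤ {b} {c} {w = w} w-shortest w′ 0<w′ = begin
    walkLength (project w)         ≡⟨ walkLength-project w ⟩
    walkLength w                   ≤⟨ w-shortest (raise b c w′ 0<w′) ⟩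
    walkLength (raise b c w′ 0<w′) ≡⟨ walkLength-raise b c w′ 0<w′ ⟩
    walkLength w′                  ∎
    where open ≤-Reasoning

  base-layer-isMutualVisibility : (∀ u v → Σ (Walk G u v) IsShortest) → (us : List (V G)) →
                                  IsMutualVisibility (Double G) (map (false ,_) us)
  base-layer-isMutualVisibility shortest-walk us x y x∈ y∈ with ∈-map⁻ (false ,_) x∈ | ∈-map⁻ (false ,_) y∈
  ... | u , _ , refl | v , _ , refl with shortest-walk u v
  ... | [] , _ = [] , (λ _ → z≤n) , []
  ... | w@(_ ∷ _) , w-shortest =
    raise false false w z<s , raise-shortest false false z<s w-shortest ,
    All.map top∉base (internals-raise false false w z<s)
    where
    top∉base : ∀ {v} → proj₁ v ≡ true → v ∉ map (false ,_) us
    top∉base refl v∈ with ∈-map⁻ (false ,_) v∈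
    ... | _ , _ , ()

Unique-lookup-injective : ∀ {A : Set} {xs : List A} → Unique xs → ∀ i j → lookup xs i ≡ lookup xs j → i ≡ j
Unique-lookup-injective (_ ∷ _)    zero    zero    _  = refl
Unique-lookup-injective (x∉xs ∷ _) zero    (suc j) eq = ⊥-elim (All.lookup x∉xs (∈-lookup j) eq)
Unique-lookup-injective (x∉xs ∷ _) (suc i) zero    eq = ⊥-elim (All.lookup x∉xs (∈-lookup i) (sym eq))
Unique-lookup-injective (_ ∷ uniq) (suc i) (suc j) eq = cong suc (Unique-lookup-injective uniq i j eq)

length-≤-injection : ∀ {A : Set} {xs : List A} {n} → Unique xs → (f : ∀ {x} → x ∈ xs → Fin n) →
                     (∀ {x y} (p : x ∈ xs) (q : y ∈ xs) → f p ≡ f q → x ≡ y) → length xs ≤ n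
length-≤-injection {xs = xs} uniq f f-injective = ≮⇒≥ λ n<len →
  let i , j , i<j , eq = Fin.pigeonhole n<len (λ i → f (∈-lookup {xs = xs} i))
  in Fin.<⇒≢ i<j (Unique-lookup-injective uniq i j (f-injective _ _ eq))

module _ (n : ℕ) .{{_ : NonZero n}} where

  infixl 6 _⊕_
  _⊕_ : Fin n → ℕ → Fin n
  x ⊕ a = fromℕ< (m%n<n (toℕ x + a) n)

  toℕ-⊕ : ∀ x a → toℕ (x ⊕ a) ≡ (toℕ x + a) % n
  toℕ-⊕ x a = Fin.toℕ-fromℕ< (m%n<n (toℕ x + a) n)

  ⊕-+ : ∀ x a b → x ⊕ a ⊕ b ≡ x ⊕ (a + b)
  ⊕-+ x a b = Fin.toℕ-injective (begin
    toℕ (x ⊕ a ⊕ b)                   ≡⟨ toℕ-⊕ (x ⊕ a) b ⟩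
    (toℕ (x ⊕ a) + b) % n             ≡⟨ cong (λ t → (t + b) % n) (toℕ-⊕ x a) ⟩
    ((toℕ x + a) % n + b) % n         ≡⟨ %-distribˡ-+ ((toℕ x + a) % n) b n ⟩
    ((toℕ x + a) % n % n + b % n) % n ≡⟨ cong (λ t → (t + b % n) % n) (m%n%n≡m%n (toℕ x + a) n) ⟩
    ((toℕ x + a) % n + b % n) % n     ≡⟨ %-distribˡ-+ (toℕ x + a) b n ⟨
    (toℕ x + a + b) % n               ≡⟨ cong (_% n) (+-assoc (toℕ x) a b) ⟩
    (toℕ x + (a + b)) % n             ≡⟨ toℕ-⊕ x (a + b) ⟨
    toℕ (x ⊕ (a + b))                 ∎)
    where open ≡-Reasoning

  ⊕-identityʳ : ∀ x → x ⊕ 0 ≡ x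
  ⊕-identityʳ x = Fin.toℕ-injective (begin
    toℕ (x ⊕ 0)       ≡⟨ toℕ-⊕ x 0 ⟩
    (toℕ x + 0) % n   ≡⟨ cong (_% n) (+-identityʳ (toℕ x)) ⟩
    toℕ x % n         ≡⟨ m<n⇒m%n≡m (Fin.toℕ<n x) ⟩
    toℕ x             ∎)
    where open ≡-Reasoning

  ⊕-n : ∀ x → x ⊕ n ≡ x
  ⊕-n x = Fin.toℕ-injective (begin
    toℕ (x ⊕ n)       ≡⟨ toℕ-⊕ x n ⟩
    (toℕ x + n) % n   ≡⟨ [m+n]%n≡m%n (toℕ x) n ⟩
    toℕ x % n         ≡⟨ m<n⇒m%n≡m (Fin.toℕ<n x) ⟩
    toℕ x             ∎)
    where open ≡-Reasoning

  ⊕-complement : ∀ x {a b} → a + b ≡ n → x ⊕ a ⊕ b ≡ x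
  ⊕-complement x {a} {b} a+b≡n = trans (⊕-+ x a b) (trans (cong (x ⊕_) a+b≡n) (⊕-n x))

  ⊕-injectiveˡ : ∀ {x y a} → a ≤ n → x ⊕ a ≡ y ⊕ a → x ≡ y
  ⊕-injectiveˡ {x} {y} {a} a≤n eq = begin
    x               ≡⟨ ⊕-complement x (m+[n∸m]≡n a≤n) ⟨
    x ⊕ a ⊕ (n ∸ a) ≡⟨ cong (_⊕ (n ∸ a)) eq ⟩
    y ⊕ a ⊕ (n ∸ a) ≡⟨ ⊕-complement y (m+[n∸m]≡n a≤n) ⟩
    y               ∎
    where open ≡-Reasoning

  toℕ-⊕-offset : ∀ x a → toℕ (x ⊕ (a + (n ∸ toℕ x))) ≡ a % n
  toℕ-⊕-offset x a = begin
    toℕ (x ⊕ (a + (n ∸ toℕ x)))     ≡⟨ toℕ-⊕ x _ ⟩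
    (toℕ x + (a + (n ∸ toℕ x))) % n ≡⟨ cong (_% n) (x∙yz≈y∙xz +-commutativeSemigroup (toℕ x) a _) ⟩
    (a + (toℕ x + (n ∸ toℕ x))) % n ≡⟨ cong (λ t → (a + t) % n) (m+[n∸m]≡n (<⇒≤ (Fin.toℕ<n x))) ⟩
    (a + n) % n                     ≡⟨ [m+n]%n≡m%n a n ⟩
    a % n                           ∎
    where open ≡-Reasoning

  ⊕-offset : ∀ x y → x ⊕ (toℕ y + (n ∸ toℕ x)) ≡ y
  ⊕-offset x y = Fin.toℕ-injective (trans (toℕ-⊕-offset x (toℕ y)) (m<n⇒m%n≡m (Fin.toℕ<n y)))

  ⊕-cancelˡ : ∀ x {a b} → a < n → b < n → x ⊕ a ≡ x ⊕ b → a ≡ b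
  ⊕-cancelˡ x {a} {b} a<n b<n eq = begin
    a                 ≡⟨ m<n⇒m%n≡m a<n ⟨
    a % n             ≡⟨ toℕ-⊕-offset x a ⟨
    toℕ (x ⊕ (a + c)) ≡⟨ cong toℕ (⊕-+ x a c) ⟨
    toℕ (x ⊕ a ⊕ c)   ≡⟨ cong (λ z → toℕ (z ⊕ c)) eq ⟩
    toℕ (x ⊕ b ⊕ c)   ≡⟨ cong toℕ (⊕-+ x b c) ⟩
    toℕ (x ⊕ (b + c)) ≡⟨ toℕ-⊕-offset x b ⟩
    b % n             ≡⟨ m<n⇒m%n≡m b<n ⟩
    b                 ∎
    where
    open ≡-Reasoning
    c : ℕ
    c = n ∸ toℕ x

  toℕ-⊕1 : ∀ x → toℕ (x ⊕ 1) ≡ suc (toℕ x) % n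
  toℕ-⊕1 x = trans (toℕ-⊕ x 1) (cong (_% n) (+-comm (toℕ x) 1))

  cycleStep⇒⊕1 : ∀ {x y} → CycleStep n x y → y ≡ x ⊕ 1
  cycleStep⇒⊕1 {x} {y} (inj₁ x+1≡y) = Fin.toℕ-injective (begin
    toℕ y              ≡⟨ x+1≡y ⟨
    suc (toℕ x)        ≡⟨ m<n⇒m%n≡m (subst (_< n) (sym x+1≡y) (Fin.toℕ<n y)) ⟨
    suc (toℕ x) % n    ≡⟨ toℕ-⊕1 x ⟨
    toℕ (x ⊕ 1)        ∎)
    where open ≡-Reasoning
  cycleStep⇒⊕1 {x} {y} (inj₂ (x+1≡n , y≡0)) = Fin.toℕ-injective (begin
    toℕ y              ≡⟨ y≡0 ⟩
    0                  ≡⟨ n%n≡0 n ⟨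
    n % n              ≡⟨ cong (_% n) x+1≡n ⟨
    suc (toℕ x) % n    ≡⟨ toℕ-⊕1 x ⟨
    toℕ (x ⊕ 1)        ∎)
    where open ≡-Reasoning

  cycleStep-⊕1 : ∀ x → CycleStep n x (x ⊕ 1)
  cycleStep-⊕1 x with m≤n⇒m<n∨m≡n (Fin.toℕ<n x)
  ... | inj₁ x+1<n = inj₁ (sym (trans (toℕ-⊕1 x) (m<n⇒m%n≡m x+1<n)))
  ... | inj₂ x+1≡n = inj₂ (x+1≡n , trans (toℕ-⊕1 x) (trans (cong (_% n) x+1≡n) (n%n≡0 n)))

  adj-⊕1 : ∀ x → Adj (Cycle n) x (x ⊕ 1)
  adj-⊕1 x = inj₁ (cycleStep-⊕1 x)

  adj⇒⊕1 : ∀ {x y} → Adj (Cycle n) x y → y ≡ x ⊕ 1 ⊎ x ≡ y ⊕ 1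
  adj⇒⊕1 (inj₁ step) = inj₁ (cycleStep⇒⊕1 step)
  adj⇒⊕1 (inj₂ step) = inj₂ (cycleStep⇒⊕1 step)

  cycleAdj? : ∀ x y → Dec (Adj (Cycle n) x y)
  cycleAdj? x y = cycleStep? x y ⊎-dec cycleStep? y x
    where
    cycleStep? : ∀ x y → Dec (CycleStep n x y)
    cycleStep? x y = (suc (toℕ x) ≟ toℕ y) ⊎-dec ((suc (toℕ x) ≟ n) ×-dec (toℕ y ≟ 0))

  forward : ∀ a {x y} → x ⊕ a ≡ y → Walk (Cycle n) x y
  forward zero {x} x⊕0≡y with trans (sym (⊕-identityʳ x)) x⊕0≡y
  ... | refl = []
  forward (suc a) {x} x⊕a≡y = adj-⊕1 x ∷ forward a (trans (⊕-+ x 1 a) x⊕a≡y)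

  walkLength-forward : ∀ a {x y} (x⊕a≡y : x ⊕ a ≡ y) → walkLength (forward a x⊕a≡y) ≡ a
  walkLength-forward zero {x} x⊕0≡y with trans (sym (⊕-identityʳ x)) x⊕0≡y
  ... | refl = refl
  walkLength-forward (suc a) {x} x⊕a≡y = cong suc (walkLength-forward a (trans (⊕-+ x 1 a) x⊕a≡y))

  wraps-around : ∀ {a x y} → a < n → x ⊕ a ≡ y → (w : Walk (Cycle n) x y) →
                 walkLength w < a → n ≤ a + walkLength w
  wraps-around {a} {x} a<n x⊕a≡x [] 0<a =
    ⊥-elim (<⇒≢ 0<a (sym (⊕-cancelˡ x a<n (>-nonZero⁻¹ n) (trans x⊕a≡x (sym (⊕-identityʳ x))))))
  wraps-around {suc a} {x} a<n x⊕a≡y (e ∷ w) w<a with adj⇒⊕1 e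
  ... | inj₁ refl = ≤-trans (wraps-around (<⇒≤ a<n) (trans (⊕-+ x 1 a) x⊕a≡y) w (≤-pred w<a))
                            (+-mono-≤ (n≤1+n a) (n≤1+n (walkLength w)))
  ... | inj₂ refl with suc (suc a) <? n
  ...   | yes a+2<n = ≤-trans (wraps-around a+2<n (trans (sym (⊕-+ _ 1 (suc a))) x⊕a≡y) w (m≤n⇒m≤1+n (<⇒≤ w<a)))
                              (≤-reflexive (sym (+-suc (suc a) (walkLength w))))
  ...   | no a+2≮n = ≤-trans (≮⇒≥ a+2≮n) (s≤s (m<m+n a z<s))

  forward-first-step : ∀ {d x z y} → suc d + suc d < n → x ⊕ suc d ≡ y →
                       Adj (Cycle n) x z → (w : Walk (Cycle n) z y) → walkLength w ≤ d → z ≡ x ⊕ 1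
  forward-first-step {d} {z = z} 2d<n x⊕d≡y e w w≤d with adj⇒⊕1 e
  ... | inj₁ z≡x⊕1 = z≡x⊕1
  ... | inj₂ refl = ⊥-elim (n≮n n (≤-<-trans wrapped 2d<n))
    where
    d+2<n : suc (suc d) < n
    d+2<n = ≤-<-trans (s≤s (m≤n+m (suc d) d)) 2d<n
    wrapped : n ≤ suc d + suc d
    wrapped = begin
      n                           ≤⟨ wraps-around d+2<n (trans (sym (⊕-+ z 1 (suc d))) x⊕d≡y) w (s≤s (m≤n⇒m≤1+n w≤d)) ⟩
      suc (suc d) + walkLength w  ≤⟨ +-monoʳ-≤ (suc (suc d)) w≤d ⟩
      suc (suc d) + d             ≡⟨ +-suc (suc d) d ⟨
      suc d + suc d               ∎
      where open ≤-Reasoning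

  forward-internals : ∀ {d i x y} → d + d < n → 0 < i → i < d → x ⊕ d ≡ y →
                      (w : Walk (Cycle n) x y) → walkLength w ≤ d → x ⊕ i ∈ internals w
  forward-internals {suc d} {_} {x} 2d<n _ _ x⊕d≡x [] _ =
    ⊥-elim (1+n≢0 (⊕-cancelˡ x (≤-<-trans (m≤m+n (suc d) (suc d)) 2d<n) (>-nonZero⁻¹ n)
                               (trans x⊕d≡x (sym (⊕-identityʳ x)))))
  forward-internals {suc d} {1} {x} 2d<n _ 1<d x⊕d≡y (e ∷ []) w≤d
    with forward-first-step 2d<n x⊕d≡y e [] (≤-pred w≤d)
  ... | refl = ⊥-elim (<⇒≢ 1<d (sym (⊕-cancelˡ x d<n (≤-<-trans (s≤s z≤n) d<n) x⊕d≡y)))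
    where
    d<n : suc d < n
    d<n = ≤-<-trans (m≤m+n (suc d) (suc d)) 2d<n
  forward-internals {suc d} {1} 2d<n _ _ x⊕d≡y (e ∷ w@(_ ∷ _)) w≤d
    with forward-first-step 2d<n x⊕d≡y e w (≤-pred w≤d)
  ... | refl = here refl
  forward-internals {suc d} {suc (suc i)} {x} 2d<n _ i<d x⊕d≡y (e ∷ w) w≤d
    with forward-first-step 2d<n x⊕d≡y e w (≤-pred w≤d)
  ... | refl = internals-∷⁺ e w (subst (_∈ internals w) (⊕-+ x 1 (suc i))
                 (forward-internals (≤-<-trans (+-mono-≤ (n≤1+n d) (n≤1+n d)) 2d<n) z<s (≤-pred i<d)
                                    (trans (⊕-+ x 1 d) x⊕d≡y) w (≤-pred w≤d)))

  module _ (S : List (Bool × Fin n)) where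

    Occupied : Fin n → Set
    Occupied k = ∃ λ b → (b , k) ∈ S

    Full : Fin n → Set
    Full k = ∀ b → (b , k) ∈ S

  full-column-blocks : ∀ {S d i x} → IsMutualVisibility (Double (Cycle n)) S → d + d < n → 0 < i → i < d →
                       Occupied S x → Full S (x ⊕ i) → ¬ Occupied S (x ⊕ d)
  full-column-blocks {S} {d} {i} {x} mv 2d<n 0<i i<d (b , x∈) full (c , y∈)
    with mv (b , x) (c , x ⊕ d) x∈ y∈
  ... | w , w-shortest , clear
    with ∈-map⁻ proj₂ (subst (x ⊕ i ∈_) (internals-project w)
                         (forward-internals 2d<n 0<i i<d refl (project w) w≤d))
    where
    0<d : 0 < walkLength (forward d refl)
    0<d = subst (0 <_) (sym (walkLength-forward d refl)) (<-trans 0<i i<d)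
    w≤d : walkLength (project w) ≤ d
    w≤d = ≤-trans (project-shortest-≤ w-shortest (forward d refl) 0<d) (≤-reflexive (walkLength-forward d refl))
  ... | v , v∈ , x⊕i≡v = All.lookup clear v∈ (subst (λ k → (proj₁ v , k) ∈ S) x⊕i≡v (full (proj₁ v)))

  module _ (7≤n : 7 ≤ n) {S : List (Bool × Fin n)} (mv : IsMutualVisibility (Double (Cycle n)) S) where

    _≟ᵥ_ : DecidableEquality (Bool × Fin n)
    _≟ᵥ_ = ≡-dec Bool._≟_ Fin._≟_

    open import Data.List.Membership.DecPropositional _≟ᵥ_ using (_∈?_)

    occupied? : ∀ k → Dec (Occupied S k)
    occupied? k with (false , k) ∈? S | (true , k) ∈? S
    ... | yes p | _     = yes (false , p)
    ... | no _  | yes q = yes (true , q)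
    ... | no p  | no q  = no λ { (false , p′) → p p′ ; (true , q′) → q q′ }

    vacant-before-full : ∀ {j k} → j ⊕ 1 ≡ k → Full S k → Occupied S (k ⊕ 1) → ¬ Occupied S j
    vacant-before-full {j} refl full next occupied =
      full-column-blocks mv (≤-trans (m≤m+n 5 2) 7≤n) z<s ≤-refl occupied full (subst (Occupied S) (⊕-+ j 1 1) next)

    vacant-beyond-full : ∀ {k} → Occupied S k → Full S (k ⊕ 1 ⊕ 1) → ¬ Occupied S (k ⊕ 1 ⊕ 1 ⊕ 1)
    vacant-beyond-full {k} occupied full next =
      full-column-blocks mv 7≤n z<s ≤-refl occupied (subst (Full S) (⊕-+ k 1 1) full)
        (subst (Occupied S) (trans (⊕-+ (k ⊕ 1) 1 1) (⊕-+ k 1 2)) next)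

    -- The targets of next and prev are vacant columns, so they never collide with base or lone.
    data _↦_ : Bool × Fin n → Fin n → Set where
      base : ∀ {k} → (false , k) ↦ k
      lone : ∀ {k} → (false , k) ∉ S → (true , k) ↦ k
      next : ∀ {k j} → j ≡ k ⊕ 1 → ¬ Occupied S j → (true , k) ↦ j
      prev : ∀ {k j} → j ⊕ 1 ≡ k → Full S k → Occupied S (k ⊕ 1) → ¬ Occupied S j → (true , k) ↦ j

    target : ∀ {x} → x ∈ S → ∃ (x ↦_)
    target {false , k} _ = k , base
    target {true , k} top∈ with (false , k) ∈? S | occupied? (k ⊕ 1)
    ... | no base∉ | _           = k , lone base∉
    ... | yes _    | no vacant   = k ⊕ 1 , next refl vacant
    ... | yes base∈ | yes occupied =
      k ⊕ (n ∸ 1) , prev j⊕1≡k full occupied (vacant-before-full j⊕1≡k full occupied)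
      where
      j⊕1≡k : k ⊕ (n ∸ 1) ⊕ 1 ≡ k
      j⊕1≡k = ⊕-complement k (m∸n+n≡m (>-nonZero⁻¹ n))
      full : Full S k
      full false = base∈
      full true  = top∈

    ↦-injective : ∀ {x y j} → x ∈ S → y ∈ S → x ↦ j → y ↦ j → x ≡ y
    ↦-injective _  _  base                base                = refl
    ↦-injective x∈ _  base                (lone base∉)        = ⊥-elim (base∉ x∈)
    ↦-injective x∈ _  base                (next _ vacant)     = ⊥-elim (vacant (_ , x∈))
    ↦-injective x∈ _  base                (prev _ _ _ vacant) = ⊥-elim (vacant (_ , x∈))
    ↦-injective _  y∈ (lone base∉)        base                = ⊥-elim (base∉ y∈)
    ↦-injective _  _  (lone _)            (lone _)            = refl
    ↦-injective x∈ _  (lone _)            (next _ vacant)     = ⊥-elim (vacant (_ , x∈))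
    ↦-injective x∈ _  (lone _)            (prev _ _ _ vacant) = ⊥-elim (vacant (_ , x∈))
    ↦-injective _  y∈ (next _ vacant)     base                = ⊥-elim (vacant (_ , y∈))
    ↦-injective _  y∈ (next _ vacant)     (lone _)            = ⊥-elim (vacant (_ , y∈))
    ↦-injective _  _  (next refl _)       (next eq _)         = cong (true ,_) (⊕-injectiveˡ (>-nonZero⁻¹ n) eq)
    ↦-injective x∈ _  (next refl _)       (prev refl full occupied _) =
      ⊥-elim (vacant-beyond-full (_ , x∈) full occupied)
    ↦-injective _  y∈ (prev _ _ _ vacant) base                = ⊥-elim (vacant (_ , y∈))
    ↦-injective _  y∈ (prev _ _ _ vacant) (lone _)            = ⊥-elim (vacant (_ , y∈))
    ↦-injective _  y∈ (prev refl full occupied _) (next refl _) =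
      ⊥-elim (vacant-beyond-full (_ , y∈) full occupied)
    ↦-injective _  _  (prev refl _ _ _)   (prev refl _ _ _)   = refl

    length-≤ : Unique S → length S ≤ n
    length-≤ unique = length-≤-injection unique (λ x∈ → proj₁ (target x∈)) λ x∈ y∈ eq →
      ↦-injective x∈ y∈ (proj₂ (target x∈)) (subst (_ ↦_) (sym eq) (proj₂ (target y∈)))

  cycle-shortest : ∀ x y → Σ (Walk (Cycle n) x y) IsShortest
  cycle-shortest x y = shortest (forward _ (⊕-offset x y))
    where open ShortestWalks (Cycle n) Fin._≟_ cycleAdj? Fin.any?

  μ-double-cycle : 7 ≤ n → MuEquals (Double (Cycle n)) n
  μ-double-cycle 7≤n =
    ( map inBase (allFin n)
    , map⁺ (cong proj₂) (allFin⁺ n)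
    , base-layer-isMutualVisibility cycle-shortest (allFin n)
    , trans (length-map inBase (allFin n)) (length-tabulate (λ k → k)) )
    , λ S unique mv → length-≤ 7≤n mv unique
    where
    inBase : Fin n → Bool × Fin n
    inBase = false ,_

theorem3p3 : (n : ℕ) → 7 ≤ n → MuEquals (Double (Cycle n)) n
theorem3p3 n 7≤n = μ-double-cycle n {{>-nonZero (≤-trans (s≤s z≤n) 7≤n)}} 7≤n
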